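{- If $D = (X,\mathcal{B})$ is a covering design such that $L(D)<1$ and $\sigma = \sum_{x \in X} \frac{1}{r_x-1}$, then \[L(D) \geq \frac{1+\sigma}{|X|+\sigma}.\]
   Context: A covering design is a pair $(X,\mathcal{B})$ with $X$ a finite set of points and $\mathcal{B}$ a finite multiset of subsets of $X$ (blocks) such that every pair of distinct points lies together in at least one block. For $x\in X$, $r_x$ is the number of blocks (with multiplicity) containing $x$. A weighting of $X$ assigns nonnegative reals, $w(S)=\sum_{x\in S}w(x)$, normalised means $w(X)=1$. $L(D,w)=\max\{w(B):B\in\mathcal{B}\}$ and $L(D)$ is the infimum of $L(D,w)$ over normalised weightings $w$ of $X$.
   Formalization: The normalised weightings of X that define L(D) take nonnegative rational values instead of nonnegative real values. -}

module Defs where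

open import Data.Bool using (Bool; true; false; if_then_else_)
open import Data.Nat as ℕ using (ℕ; zero; suc)
open import Data.Fin using (Fin)
import Data.Fin as F
open import Data.Fin.Subset using (Subset; _∈_)
open import Data.Vec using (lookup)
open import Data.List using (List; length; filter)
open import Data.List.Membership.Propositional renaming (_∈_ to _∈ᴸ_)
open import Data.Product using (Σ; ∃; _×_)
open import Data.Integer using (+_)
open import Data.Rational using (ℚ; 0ℚ; 1ℚ; _+_; _*_; _≤_; _<_; _/_)
open import Relation.Binary.PropositionalEquality using (_≡_; _≢_)
open import Data.Bool using (T)

Σℚ : ∀ {n} → (Fin n → ℚ) → ℚ
Σℚ {zero}  f = 0ℚ
Σℚ {suc n} f = f F.zero + Σℚ (λ i → f (F.suc i))

-- A covering design on X = Fin n: the blocks form a finite multiset (a list)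
-- of subsets of X, such that every pair of distinct points lies in some block.
IsCovering : ∀ {n} → List (Subset n) → Set
IsCovering {n} ℬ = ∀ (x y : Fin n) → x ≢ y → ∃ λ B → B ∈ᴸ ℬ × x ∈ B × y ∈ B

r : ∀ {n} → List (Subset n) → Fin n → ℕ
r ℬ x = length (filter (λ B → Data.Bool._≟_ (lookup B x) true) ℬ)
  where import Data.Bool

IsNormalisedWeighting : ∀ {n} → (Fin n → ℚ) → Set
IsNormalisedWeighting w = (∀ x → 0ℚ ≤ w x) × Σℚ w ≡ 1ℚ

weight : ∀ {n} → (Fin n → ℚ) → Subset n → ℚ
weight w S = Σℚ (λ x → if lookup S x then w x else 0ℚ)

LD<1 : ∀ {n} → List (Subset n) → Set
LD<1 {n} ℬ = ∃ λ (w : Fin n → ℚ) → IsNormalisedWeighting w × (∀ B → B ∈ᴸ ℬ → weight w B < 1ℚ)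

-- L(D) ≥ c : every normalised weighting has some block of weight ≥ c.
-- (c is given as a fraction num/den with den > 0, compared by cross-multiplying.)
LD≥frac : ∀ {n} → List (Subset n) → ℚ → ℚ → Set
LD≥frac {n} ℬ num den = ∀ (w : Fin n → ℚ) → IsNormalisedWeighting w →
  ∃ λ B → B ∈ᴸ ℬ × num ≤ weight w B * den

-- 1/(r-1); only used for r ≥ 2 (value for r ≤ 1 is an unreachable junk value 0).
invPred : ℕ → ℚ
invPred zero = 0ℚ
invPred (suc zero) = 0ℚ
invPred (suc (suc k)) = (+ 1) / suc k

σ : ∀ {n} → List (Subset n) → ℚ
σ ℬ = Σℚ (λ x → invPred (r ℬ x))

ℕ→ℚ : ℕ → ℚ
ℕ→ℚ m = (+ m) / 1

-- Fix a normalised weighting w and let L be its largest block weight.  Summing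
-- w(B) over the r_x blocks through a point x counts x exactly r_x times and,
-- because D is a covering, every other point at least once, so
-- 1 + (r_x - 1) w(x) ≤ r_x L.  If r_x = 1, the only block through x would be all
-- of X and have weight 1 under every weighting, contradicting L(D) < 1.  Hence
-- r_x ≥ 2, dividing by r_x - 1 gives w(x) + 1/(r_x - 1) ≤ L (1 + 1/(r_x - 1)),
-- and summing over x gives 1 + σ ≤ L (|X| + σ).

{-# OPTIONS --safe #-}
module Submission where

open import Defs
open import Data.Nat using (ℕ; _≤_)
open import Data.List using (List)
open import Data.Fin.Subset using (Subset)
open import Data.Rational using (1ℚ; _+_)

open import Algebra.Bundles using (CommutativeRing)
open import Data.Bool using (true; false; if_then_else_)
import Data.Bool as Bool
open import Data.Fin as Fin using (Fin; zero; suc; punchIn)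
open import Data.Fin.Properties using (punchInᵢ≢i)
open import Data.Integer as ℤ using (+≤+)
open import Data.Integer.Properties using (*-identityʳ)
open import Data.List using ([]; _∷_; filter; length)
open import Data.List.Membership.Propositional using () renaming (_∈_ to _∈ᴸ_)
open import Data.List.Membership.Propositional.Properties using (∈-filter⁺; ∈-filter⁻)
open import Data.List.Properties using (filter-idem)
import Data.List.Relation.Unary.All as All
open import Data.List.Relation.Unary.Any using (here; there)
open import Data.Nat using (zero; suc; z≤n; s≤s; _<_)
open import Data.Nat.Coprimality as Coprime using (1-coprimeTo)
open import Data.Nat.Properties using (≤∧≢⇒<)
open import Data.Product using (∃; _×_; _,_; proj₁; proj₂)
open import Data.Rational
  using (ℚ; 0ℚ; _*_; mkℚ; *≤*; nonNegative)
  renaming (_≤_ to _≤ℚ_)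
open import Data.Rational.Properties
  using ( ≤-refl; ≤-reflexive; <-irrefl; ≤-decTotalOrder; +-mono-≤; +-monoʳ-≤
        ; +-comm; +-identityˡ; *-identityˡ; *-zeroˡ; *-distribʳ-+; *-inverseʳ
        ; *-monoˡ-≤-nonNeg; *-monoʳ-≤-nonNeg; nonNegative⁻¹; normalize-coprime
        ; /-cong; +-*-commutativeRing; +-0-commutativeMonoid; module ≤-Reasoning)
open import Data.Rational.Solver using (module +-*-Solver)
open import Data.Sum using ([_,_]′)
open import Data.Vec using (lookup)
open import Data.Vec.Functional using (removeAt)
open import Data.Vec.Properties using ([]=⇒lookup)
open import Function using (_∘_; id)
open import Relation.Binary.Bundles using (DecTotalOrder)
open import Relation.Binary.PropositionalEquality
  using (_≡_; _≢_; refl; sym; trans; cong; subst; ≢-sym; module ≡-Reasoning)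
open import Relation.Nullary using (Dec; yes; no)

open import Algebra.Properties.Semiring.Sum (CommutativeRing.semiring +-*-commutativeRing)
  using (sum; sum-cong-≗; sum-replicate-zero; sum-remove; ∑-distrib-+; *-distribˡ-sum)
open import Algebra.Properties.CommutativeSemigroup
  (Algebra.Bundles.CommutativeMonoid.commutativeSemigroup +-0-commutativeMonoid)
  using (xy∙z≈xz∙y)
open import Data.List.Extrema (DecTotalOrder.totalOrder ≤-decTotalOrder)
  using (argmax; argmax-sel; f[xs]≤f[argmax])
open +-*-Solver using (solve; _:+_; _:*_; _:=_; con)

private
  variable
    n : ℕ

ℕ→ℚ≡mkℚ : ∀ m → ℕ→ℚ m ≡ mkℚ (ℤ.+ m) 0 (Coprime.sym (1-coprimeTo m))
ℕ→ℚ≡mkℚ m = normalize-coprime (Coprime.sym (1-coprimeTo m))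

ℕ→ℚ-suc : ∀ m → ℕ→ℚ (suc m) ≡ 1ℚ + ℕ→ℚ m
ℕ→ℚ-suc m rewrite ℕ→ℚ≡mkℚ m =
  /-cong {p₁ = ℤ.+ suc m} (sym (cong (ℤ._+_ (ℤ.+ 1)) (*-identityʳ (ℤ.+ m)))) refl

ℕ→ℚ-suc-* : ∀ m p → ℕ→ℚ (suc m) * p ≡ p + ℕ→ℚ m * p
ℕ→ℚ-suc-* m p = begin
  ℕ→ℚ (suc m) * p       ≡⟨ cong (_* p) (ℕ→ℚ-suc m) ⟩
  (1ℚ + ℕ→ℚ m) * p      ≡⟨ *-distribʳ-+ p 1ℚ (ℕ→ℚ m) ⟩
  1ℚ * p + ℕ→ℚ m * p    ≡⟨ cong (_+ ℕ→ℚ m * p) (*-identityˡ p) ⟩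
  p + ℕ→ℚ m * p         ∎
  where open ≡-Reasoning

1≤ℕ→ℚ-suc : ∀ m → 1ℚ ≤ℚ ℕ→ℚ (suc m)
1≤ℕ→ℚ-suc m rewrite ℕ→ℚ≡mkℚ (suc m) = *≤* (+≤+ (s≤s z≤n))

≤-ℕ→ℚ-* : ∀ {m p} → 0ℚ ≤ℚ p → 0 < m → p ≤ℚ ℕ→ℚ m * p
≤-ℕ→ℚ-* {suc m} {p} 0≤p _ = begin
  p                ≡⟨ sym (*-identityˡ p) ⟩
  1ℚ * p           ≤⟨ *-monoʳ-≤-nonNeg p {{nonNegative 0≤p}} (1≤ℕ→ℚ-suc m) ⟩
  ℕ→ℚ (suc m) * p  ∎
  where open ≤-Reasoning

invPred-nonNeg : ∀ m → 0ℚ ≤ℚ invPred m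
invPred-nonNeg zero = ≤-refl
invPred-nonNeg (suc zero) = ≤-refl
invPred-nonNeg (suc (suc k)) rewrite normalize-coprime {1} {k} (1-coprimeTo (suc k)) = nonNegative⁻¹ _

ℕ→ℚ*invPred : ∀ k → ℕ→ℚ (suc k) * invPred (suc (suc k)) ≡ 1ℚ
ℕ→ℚ*invPred k rewrite ℕ→ℚ≡mkℚ (suc k) | normalize-coprime {1} {k} (1-coprimeTo (suc k)) =
  *-inverseʳ (mkℚ (ℤ.+ suc k) 0 (Coprime.sym (1-coprimeTo (suc k))))

rescale-by-inverse : ∀ {a d i L} → 0ℚ ≤ℚ i → d * i ≡ 1ℚ →
  1ℚ + d * a ≤ℚ (1ℚ + d) * L → a + i ≤ℚ L * (1ℚ + i)
rescale-by-inverse {a} {d} {i} {L} 0≤i d*i≡1 bound = begin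
  a + i               ≡⟨ solve 2 (λ a i → a :+ i := i :+ con 1ℚ :* a) refl a i ⟩
  i + 1ℚ * a          ≡⟨ cong (λ t → i + t * a) (sym d*i≡1) ⟩
  i + d * i * a       ≡⟨ solve 3 (λ a d i → i :+ d :* i :* a := i :* (con 1ℚ :+ d :* a)) refl a d i ⟩
  i * (1ℚ + d * a)    ≤⟨ *-monoˡ-≤-nonNeg i {{nonNegative 0≤i}} bound ⟩
  i * ((1ℚ + d) * L)  ≡⟨ solve 3 (λ d i L → i :* ((con 1ℚ :+ d) :* L) := L :* (i :+ d :* i)) refl d i L ⟩
  L * (i + d * i)     ≡⟨ cong (λ t → L * (i + t)) d*i≡1 ⟩
  L * (i + 1ℚ)        ≡⟨ cong (L *_) (+-comm i 1ℚ) ⟩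
  L * (1ℚ + i)        ∎
  where open ≤-Reasoning

Σℚ≡sum : ∀ (f : Fin n → ℚ) → Σℚ f ≡ sum f
Σℚ≡sum {zero} f = refl
Σℚ≡sum {suc n} f = cong (f zero +_) (Σℚ≡sum (f ∘ suc))

Σℚ-cong : ∀ {f g : Fin n → ℚ} → (∀ i → f i ≡ g i) → Σℚ f ≡ Σℚ g
Σℚ-cong {f = f} {g} f≗g rewrite Σℚ≡sum f | Σℚ≡sum g = sum-cong-≗ f≗g

Σℚ-zero : Σℚ {n} (λ _ → 0ℚ) ≡ 0ℚ
Σℚ-zero {n} rewrite Σℚ≡sum {n} (λ _ → 0ℚ) = sum-replicate-zero n

Σℚ-distrib-+ : ∀ (f g : Fin n → ℚ) → Σℚ (λ i → f i + g i) ≡ Σℚ f + Σℚ g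
Σℚ-distrib-+ f g rewrite Σℚ≡sum (λ i → f i + g i) | Σℚ≡sum f | Σℚ≡sum g = ∑-distrib-+ f g

*-distribˡ-Σℚ : ∀ c (f : Fin n → ℚ) → c * Σℚ f ≡ Σℚ (λ i → c * f i)
*-distribˡ-Σℚ c f rewrite Σℚ≡sum f | Σℚ≡sum (λ i → c * f i) = *-distribˡ-sum c f

Σℚ-remove : ∀ (f : Fin (suc n) → ℚ) i → Σℚ f ≡ f i + Σℚ (removeAt f i)
Σℚ-remove f i rewrite Σℚ≡sum f | Σℚ≡sum (removeAt f i) = sum-remove f

Σℚ-mono-≤ : ∀ {f g : Fin n → ℚ} → (∀ i → f i ≤ℚ g i) → Σℚ f ≤ℚ Σℚ g
Σℚ-mono-≤ {zero} f≤g = ≤-refl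
Σℚ-mono-≤ {suc n} f≤g = +-mono-≤ (f≤g zero) (Σℚ-mono-≤ (f≤g ∘ suc))

Σℚ-1 : ∀ n → Σℚ {n} (λ _ → 1ℚ) ≡ ℕ→ℚ n
Σℚ-1 zero = refl
Σℚ-1 (suc n) = trans (cong (1ℚ +_) (Σℚ-1 n)) (sym (ℕ→ℚ-suc n))

summed-bound : ∀ (w i : Fin n → ℚ) L → Σℚ w ≡ 1ℚ → (∀ x → w x + i x ≤ℚ L * (1ℚ + i x)) →
  1ℚ + Σℚ i ≤ℚ L * (ℕ→ℚ n + Σℚ i)
summed-bound {n} w i L Σw≡1 pointwise = begin
  1ℚ + Σℚ i                           ≡⟨ cong (_+ Σℚ i) (sym Σw≡1) ⟩
  Σℚ w + Σℚ i                         ≡⟨ sym (Σℚ-distrib-+ w i) ⟩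
  Σℚ (λ x → w x + i x)                ≤⟨ Σℚ-mono-≤ pointwise ⟩
  Σℚ (λ x → L * (1ℚ + i x))           ≡⟨ sym (*-distribˡ-Σℚ L (λ x → 1ℚ + i x)) ⟩
  L * Σℚ (λ x → 1ℚ + i x)             ≡⟨ cong (L *_) (Σℚ-distrib-+ (λ _ → 1ℚ) i) ⟩
  L * (Σℚ {n} (λ _ → 1ℚ) + Σℚ i)      ≡⟨ cong (λ t → L * (t + Σℚ i)) (Σℚ-1 n) ⟩
  L * (ℕ→ℚ n + Σℚ i)                  ∎
  where open ≤-Reasoning

∈⇒0<length : ∀ {A : Set} {a : A} {xs} → a ∈ᴸ xs → 0 < length xs
∈⇒0<length (here _)  = s≤s z≤n
∈⇒0<length (there _) = s≤s z≤n

length≡1⇒∈-unique : ∀ {A : Set} {a b : A} {xs} → length xs ≡ 1 → a ∈ᴸ xs → b ∈ᴸ xs → a ≡ b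
length≡1⇒∈-unique {xs = _ ∷ []} _ (here refl) (here refl) = refl

heaviest : ∀ {A : Set} (f : A → ℚ) {a xs} → a ∈ᴸ xs →
  ∃ λ b → b ∈ᴸ xs × (∀ {c} → c ∈ᴸ xs → f c ≤ℚ f b)
heaviest f {a} {xs} a∈xs =
  argmax f a xs ,
  [ (λ argmax≡a → subst (_∈ᴸ xs) (sym argmax≡a) a∈xs) , id ]′ (argmax-sel f a xs) ,
  All.lookup (f[xs]≤f[argmax] a xs)

contains? : (x : Fin n) (B : Subset n) → Dec (lookup B x ≡ true)
contains? x B = lookup B x Bool.≟ true

through : List (Subset n) → Fin n → List (Subset n)
through ℬ x = filter (contains? x) ℬ

∈-through : ∀ {ℬ : List (Subset n)} {B x} → B ∈ᴸ ℬ → lookup B x ≡ true → B ∈ᴸ through ℬ x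
∈-through {x = x} = ∈-filter⁺ (contains? x)

through⁻ : ∀ {ℬ : List (Subset n)} {B x} → B ∈ᴸ through ℬ x → B ∈ᴸ ℬ × lookup B x ≡ true
through⁻ {x = x} = ∈-filter⁻ (contains? x)

r-through-self : ∀ (ℬ : List (Subset n)) x → r (through ℬ x) x ≡ r ℬ x
r-through-self ℬ x = cong length (filter-idem (contains? x) ℬ)

incidence : (Fin n → ℚ) → List (Subset n) → ℚ
incidence w 𝒞 = Σℚ (λ y → ℕ→ℚ (r 𝒞 y) * w y)

incidence-[] : ∀ (w : Fin n → ℚ) → incidence w [] ≡ 0ℚ
incidence-[] {n} w = trans (Σℚ-cong (λ y → *-zeroˡ (w y))) (Σℚ-zero {n})

incidence-∷ : ∀ (w : Fin n → ℚ) B 𝒞 → incidence w (B ∷ 𝒞) ≡ weight w B + incidence w 𝒞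
incidence-∷ w B 𝒞 = trans (Σℚ-cong split) (Σℚ-distrib-+ (λ y → if lookup B y then w y else 0ℚ) _)
  where
  split : ∀ y → ℕ→ℚ (r (B ∷ 𝒞) y) * w y ≡ (if lookup B y then w y else 0ℚ) + ℕ→ℚ (r 𝒞 y) * w y
  -- Once lookup B y is known, the filter inside r (B ∷ 𝒞) y computes.
  split y with lookup B y
  ... | true  = ℕ→ℚ-suc-* (r 𝒞 y) (w y)
  ... | false = sym (+-identityˡ _)

incidence-≤ : ∀ (w : Fin n → ℚ) 𝒞 {L} → (∀ {B} → B ∈ᴸ 𝒞 → weight w B ≤ℚ L) →
  incidence w 𝒞 ≤ℚ ℕ→ℚ (length 𝒞) * L
incidence-≤ w [] {L} _ = ≤-reflexive (trans (incidence-[] w) (sym (*-zeroˡ L)))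
incidence-≤ w (B ∷ 𝒞) {L} bounded = begin
  incidence w (B ∷ 𝒞)            ≡⟨ incidence-∷ w B 𝒞 ⟩
  weight w B + incidence w 𝒞     ≤⟨ +-mono-≤ (bounded (here refl)) (incidence-≤ w 𝒞 (bounded ∘ there)) ⟩
  L + ℕ→ℚ (length 𝒞) * L         ≡⟨ sym (ℕ→ℚ-suc-* (length 𝒞) L) ⟩
  ℕ→ℚ (length (B ∷ 𝒞)) * L       ∎
  where open ≤-Reasoning

other-point : 2 ≤ n → (x : Fin n) → ∃ λ y → x ≢ y
other-point (s≤s (s≤s z≤n)) zero    = suc zero , λ ()
other-point (s≤s (s≤s z≤n)) (suc _) = zero , λ ()

shared-block-through : (ℬ : List (Subset n)) → IsCovering ℬ → ∀ {x y} → x ≢ y →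
  ∃ λ B → B ∈ᴸ through ℬ x × lookup B y ≡ true
shared-block-through ℬ cov x≢y with cov _ _ x≢y
... | B , B∈ℬ , x∈B , y∈B = B , ∈-through {ℬ = ℬ} B∈ℬ ([]=⇒lookup x∈B) , []=⇒lookup y∈B

some-block : 2 ≤ n → (ℬ : List (Subset n)) → IsCovering ℬ → ∃ λ B → B ∈ᴸ ℬ
some-block 2≤n@(s≤s _) ℬ cov =
  let B , B∈ , _ = shared-block-through ℬ cov (proj₂ (other-point 2≤n zero))
  in B , proj₁ (through⁻ {ℬ = ℬ} B∈)

r-through-pos : (ℬ : List (Subset n)) → IsCovering ℬ → ∀ {x y} → x ≢ y → 0 < r (through ℬ x) y
r-through-pos ℬ cov {x} x≢y with shared-block-through ℬ cov x≢y
... | B , B∈ , y∈B = ∈⇒0<length (∈-through {ℬ = through ℬ x} B∈ y∈B)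

through-unique⇒full : (ℬ : List (Subset n)) → IsCovering ℬ → ∀ {x B} → B ∈ᴸ through ℬ x →
  (∀ {C} → C ∈ᴸ through ℬ x → C ≡ B) → ∀ y → lookup B y ≡ true
through-unique⇒full ℬ cov {x} B∈ unique y with x Fin.≟ y
... | yes refl = proj₂ (through⁻ {ℬ = ℬ} B∈)
... | no x≢y with shared-block-through ℬ cov x≢y
...   | C , C∈ , y∈C = subst (λ D → lookup D y ≡ true) (unique C∈) y∈C

weight-full : ∀ (w : Fin n → ℚ) B → (∀ y → lookup B y ≡ true) → weight w B ≡ Σℚ w
weight-full w B full = Σℚ-cong (λ y → cong (λ b → if b then w y else 0ℚ) (full y))

2≤r : 2 ≤ n → (ℬ : List (Subset n)) → IsCovering ℬ → LD<1 ℬ → ∀ x → 2 ≤ r ℬ x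
2≤r 2≤n ℬ cov (w , (_ , Σw≡1) , light) x with other-point 2≤n x
... | y , x≢y with shared-block-through ℬ cov x≢y
...   | B , B∈ , _ = ≤∧≢⇒< (∈⇒0<length B∈) not-1
  where
  B∈ℬ : B ∈ᴸ ℬ
  B∈ℬ = proj₁ (through⁻ {ℬ = ℬ} B∈)
  not-1 : 1 ≢ r ℬ x
  not-1 1≡r = <-irrefl (trans (weight-full w B full) Σw≡1) (light B B∈ℬ)
    where
    full : ∀ z → lookup B z ≡ true
    full = through-unique⇒full ℬ cov B∈ (λ C∈ → length≡1⇒∈-unique (sym 1≡r) C∈ B∈)

local-bound : (ℬ : List (Subset (suc n))) → IsCovering ℬ → ∀ w L → IsNormalisedWeighting w →
  (∀ {B} → B ∈ᴸ ℬ → weight w B ≤ℚ L) →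
  ∀ x {d} → r ℬ x ≡ suc d → 1ℚ + ℕ→ℚ d * w x ≤ℚ (1ℚ + ℕ→ℚ d) * L
local-bound {n} ℬ cov w L (w≥0 , Σw≡1) bounded x {d} rₓ = begin
  1ℚ + ℕ→ℚ d * w x                        ≡⟨ cong (_+ ℕ→ℚ d * w x) (trans (sym Σw≡1) (Σℚ-remove w x)) ⟩
  w x + Σℚ (removeAt w x) + ℕ→ℚ d * w x   ≡⟨ xy∙z≈xz∙y (w x) _ _ ⟩
  w x + ℕ→ℚ d * w x + Σℚ (removeAt w x)   ≡⟨ cong (_+ Σℚ (removeAt w x)) (sym (ℕ→ℚ-suc-* d (w x))) ⟩
  ℕ→ℚ (suc d) * w x + Σℚ (removeAt w x)   ≡⟨ cong (λ m → ℕ→ℚ m * w x + Σℚ (removeAt w x)) r𝒞x≡1+d ⟨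
  c x + Σℚ (removeAt w x)                 ≤⟨ +-monoʳ-≤ (c x) (Σℚ-mono-≤ others) ⟩
  c x + Σℚ (removeAt c x)                 ≡⟨ Σℚ-remove c x ⟨
  incidence w 𝒞                           ≤⟨ incidence-≤ w 𝒞 (bounded ∘ proj₁ ∘ through⁻ {ℬ = ℬ}) ⟩
  ℕ→ℚ (r ℬ x) * L                         ≡⟨ cong (λ m → ℕ→ℚ m * L) rₓ ⟩
  ℕ→ℚ (suc d) * L                         ≡⟨ cong (_* L) (ℕ→ℚ-suc d) ⟩
  (1ℚ + ℕ→ℚ d) * L                        ∎
  where
  open ≤-Reasoning
  𝒞 : List (Subset (suc n))
  𝒞 = through ℬ x
  c : Fin (suc n) → ℚ
  c y = ℕ→ℚ (r 𝒞 y) * w y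
  r𝒞x≡1+d : r 𝒞 x ≡ suc d
  r𝒞x≡1+d = trans (r-through-self ℬ x) rₓ
  others : ∀ j → w (punchIn x j) ≤ℚ c (punchIn x j)
  others j = ≤-ℕ→ℚ-* (w≥0 _) (r-through-pos ℬ cov (≢-sym (punchInᵢ≢i x j)))

point-bound : 2 ≤ suc n → (ℬ : List (Subset (suc n))) → IsCovering ℬ → LD<1 ℬ →
  ∀ w L → IsNormalisedWeighting w → (∀ {B} → B ∈ᴸ ℬ → weight w B ≤ℚ L) →
  ∀ x → w x + invPred (r ℬ x) ≤ℚ L * (1ℚ + invPred (r ℬ x))
point-bound 2≤n ℬ cov ld w L w-norm bounded x with r ℬ x in rₓ | 2≤r 2≤n ℬ cov ld x
... | suc zero    | s≤s ()
... | suc (suc k) | _ =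
  rescale-by-inverse {d = ℕ→ℚ (suc k)} (invPred-nonNeg (suc (suc k))) (ℕ→ℚ*invPred k)
    (local-bound ℬ cov w L w-norm bounded x rₓ)

lemma6p4 : (n : ℕ) → 2 ≤ n → (ℬ : List (Subset n)) → IsCovering ℬ → LD<1 ℬ →
    LD≥frac ℬ (1ℚ + σ ℬ) (ℕ→ℚ n + σ ℬ)
lemma6p4 n@(suc _) 2≤n ℬ cov ld w w-norm@(_ , Σw≡1) =
  let B₀ , B₀∈ℬ = some-block 2≤n ℬ cov
      B , B∈ℬ , lighter = heaviest (weight w) B₀∈ℬ
  in B , B∈ℬ , summed-bound w (λ x → invPred (r ℬ x)) (weight w B) Σw≡1
                 (point-bound 2≤n ℬ cov ld w (weight w B) w-norm lighter)
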